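{- Let $T$ be a semi-complete digraph, $k\ge 0$ an integer, and $m=100k^2+22k+1$. If $T$ contains an $(m+1)$-backward tangle, then $\mathbf{ctw}(T)>k$.
   Context: All digraphs are simple. A digraph $T$ is semi-complete if for every two distinct vertices $v,w$ at least one of the arcs $(v,w)$, $(w,v)$ is present. $d^+(v)$ is the outdegree of $v$. A $k$-backward tangle is a partition $(X,Y)$ of $V(T)$ such that (i) at least $k$ arcs are directed from $X$ to $Y$, and (ii) $d^+(w)\ge d^+(v)$ for every $v\in X$, $w\in Y$. For an ordering $\pi$ of $V=V(T)$, $\pi[\alpha]$ is the set of its first $\alpha$ vertices, $E(A,B)$ is the set of arcs from $A$ to $B$, the width of $\pi$ is $\max_{0\le\alpha\le|V|}|E(\pi[\alpha],V\setminus\pi[\alpha])|$, and the cutwidth $\mathbf{ctw}(T)$ is the minimum width over all orderings. -}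

module Defs where

open import Data.Nat using (ℕ; zero; suc; _+_; _*_; _≤_; _<_; _⊔_; _<ᵇ_)
open import Data.Bool using (Bool; true; false; _∧_; not; if_then_else_)
open import Data.Fin using (Fin; toℕ)
open import Data.Fin.Permutation using (Permutation′; _⟨$⟩ˡ_)
open import Data.List using (List; map; foldr; allFin; upTo)
open import Data.Nat.ListAction using (sum)
open import Data.Product using (Σ; _×_)
open import Data.Sum using (_⊎_)
open import Relation.Binary.PropositionalEquality using (_≡_; _≢_)

record SemiComplete (n : ℕ) : Set where
  field
    adj          : Fin n → Fin n → Bool
    loopless     : ∀ v → adj v v ≡ false
    semicomplete : ∀ v w → v ≢ w → adj v w ≡ true ⊎ adj w v ≡ true
open SemiComplete public

count : ∀ {n} → (Fin n → Bool) → ℕ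
count {n} p = sum (map (λ i → if p i then 1 else 0) (allFin n))

outdeg : ∀ {n} → SemiComplete n → Fin n → ℕ
outdeg T v = count (λ w → adj T v w)

arcs : ∀ {n} → SemiComplete n → (Fin n → Bool) → (Fin n → Bool) → ℕ
arcs {n} T A B = sum (map (λ v → count (λ w → A v ∧ B w ∧ adj T v w)) (allFin n))

compl : ∀ {n} → (Fin n → Bool) → (Fin n → Bool)
compl X v = not (X v)

BackwardTangle : ∀ {n} → SemiComplete n → ℕ → (Fin n → Bool) → Set
BackwardTangle T k X =
  (k ≤ arcs T X (compl X)) ×
  (∀ v w → X v ≡ true → X w ≡ false → outdeg T v ≤ outdeg T w)

HasBackwardTangle : ∀ {n} → SemiComplete n → ℕ → Set
HasBackwardTangle {n} T k = Σ (Fin n → Bool) (BackwardTangle T k)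

-- An ordering π of V is a permutation: π(i) is the i-th vertex (0-based).
-- π[α] = set of the first α vertices = {v | position of v < α}
prefix : ∀ {n} → Permutation′ n → ℕ → (Fin n → Bool)
prefix π α v = toℕ (π ⟨$⟩ˡ v) <ᵇ α

width : ∀ {n} → SemiComplete n → Permutation′ n → ℕ
width {n} T π =
  foldr _⊔_ 0 (map (λ α → arcs T (prefix π α) (compl (prefix π α))) (upTo (suc n)))

-- ctw(T) > k: the minimum width over all orderings exceeds k,
-- i.e. every ordering has width > k.
CtwGreaterThan : ∀ {n} → SemiComplete n → ℕ → Set
CtwGreaterThan {n} T k = (π : Permutation′ n) → k < width T π

module Submission where

-- Suppose an ordering π has width at most k, i.e. every cut E(π[α], V ∖ π[α])
-- carries at most k arcs.  Then every vertex sits within k of its out-degree: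
-- d⁺(v) ≤ pos(v) + k (out-neighbours of v are either earlier than v, or leave
-- the cut just after v) and pos(v) ≤ d⁺(v) + k (each earlier vertex is an
-- out-neighbour of v or sends an arc across the cut just before v).
-- Given a backward tangle (X, Y), choose a threshold D with d⁺(X) ≤ D ≤ d⁺(Y).
-- Then X lies in the prefix Q = π[D + k + 1] and Y avoids the prefix
-- P = π[D ∸ k], so every X→Y arc leaves P, leaves Q, or joins two vertices of
-- the window Q ∖ P of at most 2k + 1 vertices.  Hence there are at most
-- 2k + (2k + 1)² arcs from X to Y, fewer than 100k² + 22k + 2.

open import Defs
open import Data.Nat using (ℕ; zero; suc; _+_; _*_; _∸_; _⊓_; _⊔_; _≤_; _<_; _≮_; _<ᵇ_; z≤n; s≤s; z<s; _≤?_; _<?_)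
open import Data.Nat.Properties
open import Data.Bool using (Bool; true; false; _∧_; not; if_then_else_)
open import Data.Bool.Properties using (∧-zeroʳ; ∧-identityʳ)
open import Data.Fin using (Fin; zero; suc; toℕ)
open import Data.Fin.Properties using (toℕ<n; toℕ-injective)
open import Data.Fin.Permutation using (Permutation′; _⟨$⟩ˡ_; _⟨$⟩ʳ_; flip; inverseʳ)
open import Data.List using (List; []; _∷_; map; foldr; tabulate; allFin)
open import Data.List.Properties using (map-tabulate)
import Data.Nat.ListAction as List
open import Data.List.Membership.Propositional using (_∈_)
open import Data.List.Membership.Propositional.Properties using (∈-allFin; ∈-upTo⁺)
open import Data.List.Relation.Unary.Any using (here; there)
open import Data.Product using (Σ; _×_; _,_)
open import Data.Sum using (inj₁; inj₂)
open import Data.Empty using (⊥-elim)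
open import Relation.Nullary using (yes; no)
open import Relation.Nullary.Reflects using (ofʸ; ofⁿ)
open import Relation.Binary.PropositionalEquality
open import Algebra.Properties.Semiring.Sum +-*-semiring
  using (sum-syntax; sum-cong-≗; sum-remove; sum-permute; sum-replicate-zero;
         ∑-distrib-+; *-distribˡ-sum; *-distribʳ-sum)
open import Data.Nat.Tactic.RingSolver using (solve-∀)

ind : Bool → ℕ
ind b = if b then 1 else 0

ind≤1 : ∀ b → ind b ≤ 1
ind≤1 true  = ≤-refl
ind≤1 false = z≤n

-- The list sums of Defs agree with the library's sums ∑[ i < n ] over Fin n,
-- for which permutation invariance and distributivity are available.
sum-tabulate : ∀ {n} (f : Fin n → ℕ) → List.sum (tabulate f) ≡ (∑[ i < n ] f i)
sum-tabulate {zero}  f = refl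
sum-tabulate {suc n} f = cong (f zero +_) (sum-tabulate (λ i → f (suc i)))

count≡∑ : ∀ {n} (p : Fin n → Bool) → count p ≡ (∑[ v < n ] ind (p v))
count≡∑ {n} p = trans (cong List.sum (map-tabulate (λ i → i) f)) (sum-tabulate f)
  where
  f : Fin n → ℕ
  f v = ind (p v)

arcs≡∑ : ∀ {n} (T : SemiComplete n) (A B : Fin n → Bool) →
         arcs T A B ≡ ∑[ v < n ] ∑[ w < n ] ind (A v ∧ B w ∧ adj T v w)
arcs≡∑ {n} T A B =
  trans (cong List.sum (map-tabulate (λ i → i) row))
        (trans (sum-tabulate row) (sum-cong-≗ (λ v → count≡∑ (λ w → A v ∧ B w ∧ adj T v w))))
  where
  row : Fin n → ℕ
  row v = count (λ w → A v ∧ B w ∧ adj T v w)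

∑-mono : ∀ {n} {f g : Fin n → ℕ} → (∀ i → f i ≤ g i) → (∑[ i < n ] f i) ≤ (∑[ i < n ] g i)
∑-mono {zero}  f≤g = z≤n
∑-mono {suc n} f≤g = +-mono-≤ (f≤g zero) (∑-mono (λ i → f≤g (suc i)))

term≤∑ : ∀ {n} (f : Fin n → ℕ) i → f i ≤ (∑[ j < n ] f j)
term≤∑ {suc n} f i = ≤-trans (m≤m+n (f i) _) (≤-reflexive (sym (sum-remove {i = i} f)))

∑-zero : ∀ {n} (f : Fin n → ℕ) → (∀ i → f i ≡ 0) → (∑[ i < n ] f i) ≡ 0
∑-zero {n} f f≡0 = trans (sum-cong-≗ f≡0) (sum-replicate-zero n)

∑-reindex : ∀ {n} (π : Permutation′ n) (f : Fin n → ℕ) →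
            (∑[ v < n ] f (π ⟨$⟩ˡ v)) ≡ (∑[ i < n ] f i)
∑-reindex π f = sym (sum-permute f (flip π))

∑∑-split : ∀ {n} (f g : Fin n → Fin n → ℕ) (h : Fin n → ℕ) →
           (∑[ v < n ] ∑[ w < n ] (f v w + g v w + h v * h w))
           ≡ (∑[ v < n ] ∑[ w < n ] f v w) + (∑[ v < n ] ∑[ w < n ] g v w)
             + (∑[ v < n ] h v) * (∑[ w < n ] h w)
∑∑-split {n} f g h = begin
  (∑[ v < n ] ∑[ w < n ] (f v w + g v w + h v * h w))
    ≡⟨ sum-cong-≗ inner ⟩
  (∑[ v < n ] (F v + G v + h v * H))
    ≡⟨ ∑-distrib-+ (λ v → F v + G v) (λ v → h v * H) ⟩
  (∑[ v < n ] (F v + G v)) + (∑[ v < n ] (h v * H))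
    ≡⟨ cong₂ _+_ (∑-distrib-+ F G) (sym (*-distribʳ-sum H h)) ⟩
  (∑[ v < n ] F v) + (∑[ v < n ] G v) + H * H ∎
  where
  open ≡-Reasoning
  F G : Fin n → ℕ
  F v = ∑[ w < n ] f v w
  G v = ∑[ w < n ] g v w
  H : ℕ
  H = ∑[ w < n ] h w
  inner : ∀ v → (∑[ w < n ] (f v w + g v w + h v * h w)) ≡ F v + G v + h v * H
  inner v = trans (∑-distrib-+ (λ w → f v w + g v w) (λ w → h v * h w))
                  (cong₂ _+_ (∑-distrib-+ (f v) (g v)) (sym (*-distribˡ-sum (h v) h)))

maximum : List ℕ → ℕ
maximum = foldr _⊔_ 0

≤-maximum : ∀ {A : Set} (f : A → ℕ) {x xs} → x ∈ xs → f x ≤ maximum (map f xs)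
≤-maximum f (here refl) = m≤m⊔n _ _
≤-maximum f (there x∈xs) = ≤-trans (≤-maximum f x∈xs) (m≤n⊔m _ _)

maximum-≤ : ∀ {A : Set} (f : A → ℕ) {c} xs → (∀ x → f x ≤ c) → maximum (map f xs) ≤ c
maximum-≤ f []       f≤c = z≤n
maximum-≤ f (x ∷ xs) f≤c = ⊔-lub (f≤c x) (maximum-≤ f xs f≤c)

<ᵇ-true : ∀ {m n} → m < n → (m <ᵇ n) ≡ true
<ᵇ-true {m} {n} m<n with m <ᵇ n | <ᵇ-reflects-< m n
... | true  | _       = refl
... | false | ofⁿ m≮n = ⊥-elim (m≮n m<n)

<ᵇ-false : ∀ {m n} → m ≮ n → (m <ᵇ n) ≡ false
<ᵇ-false {m} {n} m≮n with m <ᵇ n | <ᵇ-reflects-< m n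
... | true  | ofʸ m<n = ⊥-elim (m≮n m<n)
... | false | _       = refl

pos : ∀ {n} → Permutation′ n → Fin n → ℕ
pos π v = toℕ (π ⟨$⟩ˡ v)

pos-injective : ∀ {n} (π : Permutation′ n) {v w} → pos π v ≡ pos π w → v ≡ w
pos-injective π {v} {w} eq = begin
  v                             ≡⟨ inverseʳ π ⟨
  π ⟨$⟩ʳ (π ⟨$⟩ˡ v)             ≡⟨ cong (π ⟨$⟩ʳ_) (toℕ-injective eq) ⟩
  π ⟨$⟩ʳ (π ⟨$⟩ˡ w)             ≡⟨ inverseʳ π ⟩
  w                             ∎
  where open ≡-Reasoning

count-below : ∀ n α → (∑[ i < n ] ind (toℕ i <ᵇ α)) ≡ α ⊓ n
count-below zero    α       = sym (⊓-zeroʳ α)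
count-below (suc n) zero    = count-below n zero
count-below (suc n) (suc α) = cong suc (count-below n α)

count-prefix : ∀ {n} (π : Permutation′ n) α → (∑[ v < n ] ind (prefix π α v)) ≡ α ⊓ n
count-prefix {n} π α = trans (∑-reindex π (λ i → ind (toℕ i <ᵇ α))) (count-below n α)

cut : ∀ {n} → SemiComplete n → Permutation′ n → ℕ → ℕ
cut T π α = arcs T (prefix π α) (compl (prefix π α))

-- Every cut is bounded by the width: cuts with α ≤ n occur in the maximum
-- defining the width, and for α ≥ n the prefix is everything, so the cut is empty.
cut-beyond : ∀ {n} (T : SemiComplete n) (π : Permutation′ n) {α} → n ≤ α → cut T π α ≡ 0
cut-beyond {n} T π {α} n≤α =
  trans (arcs≡∑ T P (compl P)) (∑-zero _ (λ v → ∑-zero _ (λ w → no-arc v w)))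
  where
  P : Fin n → Bool
  P = prefix π α
  no-arc : ∀ v w → ind (P v ∧ not (P w) ∧ adj T v w) ≡ 0
  no-arc v w rewrite <ᵇ-true {pos π w} {α} (<-≤-trans (toℕ<n _) n≤α) = cong ind (∧-zeroʳ (P v))

cut≤width : ∀ {n} (T : SemiComplete n) (π : Permutation′ n) α → cut T π α ≤ width T π
cut≤width {n} T π α with α <? suc n
... | yes α≤n = ≤-maximum (cut T π) (∈-upTo⁺ α≤n)
... | no  α≮n = ≤-trans (≤-reflexive (cut-beyond T π (<⇒≤ (≮⇒≥ α≮n)))) z≤n

row≤arcs : ∀ {n} (T : SemiComplete n) (A B : Fin n → Bool) v →
           (∑[ w < n ] ind (A v ∧ B w ∧ adj T v w)) ≤ arcs T A B
row≤arcs T A B v =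
  ≤-trans (term≤∑ (λ u → ∑[ w < _ ] ind (A u ∧ B w ∧ adj T u w)) v)
          (≤-reflexive (sym (arcs≡∑ T A B)))

column≤arcs : ∀ {n} (T : SemiComplete n) (A B : Fin n → Bool) w →
              (∑[ v < n ] ind (A v ∧ B w ∧ adj T v w)) ≤ arcs T A B
column≤arcs T A B w =
  ≤-trans (∑-mono (λ v → term≤∑ (λ u → ind (A v ∧ B u ∧ adj T v u)) w))
          (≤-reflexive (sym (arcs≡∑ T A B)))

_∖_ : ∀ {n} → (Fin n → Bool) → (Fin n → Bool) → (Fin n → Bool)
(Q ∖ P) v = Q v ∧ not (P v)

-- Covering lemma: if X ⊆ Q and V ∖ X is disjoint from P, an arc from X to V ∖ X
-- either leaves P, leaves Q, or has both ends in Q ∖ P.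
arcs≤two-cuts+window : ∀ {n} (T : SemiComplete n) (X P Q : Fin n → Bool) →
  (∀ v → X v ≡ true → Q v ≡ true) → (∀ w → X w ≡ false → P w ≡ false) →
  arcs T X (compl X) ≤ arcs T P (compl P) + arcs T Q (compl Q) + count (Q ∖ P) * count (Q ∖ P)
arcs≤two-cuts+window {n} T X P Q X⊆Q Y∩P=∅ = begin
  arcs T X (compl X)
    ≡⟨ arcs≡∑ T X (compl X) ⟩
  ∑[ v < n ] ∑[ w < n ] ind (X v ∧ not (X w) ∧ adj T v w)
    ≤⟨ ∑-mono (λ v → ∑-mono (split v)) ⟩
  ∑[ v < n ] ∑[ w < n ] (leaving P v w + leaving Q v w + ind (W v) * ind (W w))
    ≡⟨ ∑∑-split (leaving P) (leaving Q) (λ v → ind (W v)) ⟩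
  ∑[ v < n ] ∑[ w < n ] leaving P v w + ∑[ v < n ] ∑[ w < n ] leaving Q v w
    + ∑[ v < n ] ind (W v) * ∑[ w < n ] ind (W w)
    ≡⟨ cong₂ _+_ (cong₂ _+_ (arcs≡∑ T P (compl P)) (arcs≡∑ T Q (compl Q)))
                 (cong₂ _*_ (count≡∑ W) (count≡∑ W)) ⟨
  arcs T P (compl P) + arcs T Q (compl Q) + count W * count W ∎
  where
  open ≤-Reasoning
  W : Fin n → Bool
  W = Q ∖ P
  leaving : (Fin n → Bool) → Fin n → Fin n → ℕ
  leaving A v w = ind (A v ∧ not (A w) ∧ adj T v w)
  split : ∀ v w → ind (X v ∧ not (X w) ∧ adj T v w)
                  ≤ leaving P v w + leaving Q v w + ind (W v) * ind (W w)
  split v w with X v in Xv | X w in Xw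
  ... | false | _     = z≤n
  ... | true  | true  = z≤n
  ... | true  | false rewrite X⊆Q v Xv | Y∩P=∅ w Xw with P v | Q w
  ...   | true  | _     = ≤-trans (m≤m+n _ _) (m≤m+n _ _)
  ...   | false | false = m≤m+n (ind (adj T v w)) 0
  ...   | false | true  = ind≤1 (adj T v w)

⊓-shift : ∀ {a b} n → a ≤ b → b ⊓ n ≤ b ∸ a + a ⊓ n
⊓-shift {a} {b} n a≤b with ≤-total a n
... | inj₁ a≤n = begin
  b ⊓ n          ≤⟨ m⊓n≤m b n ⟩
  b              ≡⟨ m∸n+n≡m a≤b ⟨
  b ∸ a + a      ≡⟨ cong (b ∸ a +_) (m≤n⇒m⊓n≡m a≤n) ⟨
  b ∸ a + a ⊓ n  ∎
  where open ≤-Reasoning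
... | inj₂ n≤a = begin
  b ⊓ n          ≤⟨ m⊓n≤n b n ⟩
  n              ≤⟨ m≤n+m n (b ∸ a) ⟩
  b ∸ a + n      ≡⟨ cong (b ∸ a +_) (m≥n⇒m⊓n≡n n≤a) ⟨
  b ∸ a + a ⊓ n  ∎
  where open ≤-Reasoning

count-window : ∀ {n} (π : Permutation′ n) {a b} → a ≤ b →
               count (prefix π b ∖ prefix π a) ≤ b ∸ a
count-window {n} π {a} {b} a≤b = +-cancelʳ-≤ (a ⊓ n) _ _ (begin
  count (B ∖ A) + a ⊓ n
    ≡⟨ cong₂ _+_ (count≡∑ (B ∖ A)) (sym (count-prefix π a)) ⟩
  ∑[ v < n ] ind ((B ∖ A) v) + ∑[ v < n ] ind (A v)
    ≡⟨ ∑-distrib-+ (λ v → ind ((B ∖ A) v)) (λ v → ind (A v)) ⟨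
  ∑[ v < n ] (ind ((B ∖ A) v) + ind (A v))
    ≡⟨ sum-cong-≗ split ⟩
  ∑[ v < n ] ind (B v)
    ≡⟨ count-prefix π b ⟩
  b ⊓ n
    ≤⟨ ⊓-shift n a≤b ⟩
  b ∸ a + a ⊓ n ∎)
  where
  open ≤-Reasoning
  A B : Fin n → Bool
  A = prefix π a
  B = prefix π b
  split : ∀ v → ind ((B ∖ A) v) + ind (A v) ≡ ind (B v)
  split v with pos π v <ᵇ a | <ᵇ-reflects-< (pos π v) a
  ... | true  | ofʸ v<a rewrite <ᵇ-true {pos π v} {b} (<-≤-trans v<a a≤b) = refl
  ... | false | _       = trans (+-identityʳ _) (cong ind (∧-identityʳ (B v)))

-- If f(v) ≤ f(w) for all v ∈ X and w ∉ X, a single threshold D separates the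
-- values on X from those outside X (take D the maximum of f over X).
separating-threshold : ∀ {n} (X : Fin n → Bool) (f : Fin n → ℕ) →
  (∀ v w → X v ≡ true → X w ≡ false → f v ≤ f w) →
  Σ ℕ λ D → (∀ v → X v ≡ true → f v ≤ D) × (∀ w → X w ≡ false → D ≤ f w)
separating-threshold {n} X f sorted = D , below , above
  where
  g : Fin n → ℕ
  g v = if X v then f v else 0
  D : ℕ
  D = maximum (map g (allFin n))
  below : ∀ v → X v ≡ true → f v ≤ D
  below v Xv = subst (λ b → (if b then f v else 0) ≤ D) Xv (≤-maximum g (∈-allFin v))
  above : ∀ w → X w ≡ false → D ≤ f w
  above w Xw = maximum-≤ g (allFin n) g≤fw
    where
    g≤fw : ∀ v → g v ≤ f w
    g≤fw v with X v in Xv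
    ... | true  = sorted v w Xv Xw
    ... | false = z≤n

window-rearrange : ∀ k x → suc (k + x + k) ≡ x + suc (k + k)
window-rearrange = solve-∀

window-length : ∀ D k → suc (D + k) ∸ (D ∸ k) ≤ suc (k + k)
window-length D k = m≤n+o⇒m∸n≤o (suc (D + k)) (D ∸ k) (begin
  suc (D + k)              ≤⟨ s≤s (+-monoˡ-≤ k (m≤n+m∸n D k)) ⟩
  suc (k + (D ∸ k) + k)    ≡⟨ window-rearrange k (D ∸ k) ⟩
  D ∸ k + suc (k + k)      ∎)
  where open ≤-Reasoning

module SmallCuts {n} (T : SemiComplete n) (π : Permutation′ n) (k : ℕ)
                 (small-cuts : ∀ α → cut T π α ≤ k) where

  -- An out-neighbour w of v is before v, or the arc v → w leaves π[pos v + 1].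
  outdeg≤pos+k : ∀ v → outdeg T v ≤ pos π v + k
  outdeg≤pos+k v = begin
    outdeg T v
      ≡⟨ count≡∑ (adj T v) ⟩
    ∑[ w < n ] ind (adj T v w)
      ≤⟨ ∑-mono split ⟩
    ∑[ w < n ] (ind (P w) + ind (R v ∧ not (R w) ∧ adj T v w))
      ≡⟨ ∑-distrib-+ (λ w → ind (P w)) (λ w → ind (R v ∧ not (R w) ∧ adj T v w)) ⟩
    ∑[ w < n ] ind (P w) + ∑[ w < n ] ind (R v ∧ not (R w) ∧ adj T v w)
      ≤⟨ +-mono-≤ (≤-trans (≤-reflexive (count-prefix π (pos π v))) (m⊓n≤m _ _))
                  (≤-trans (row≤arcs T R (compl R) v) (small-cuts (suc (pos π v)))) ⟩
    pos π v + k ∎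
    where
    open ≤-Reasoning
    P R : Fin n → Bool
    P = prefix π (pos π v)
    R = prefix π (suc (pos π v))
    split : ∀ w → ind (adj T v w) ≤ ind (P w) + ind (R v ∧ not (R w) ∧ adj T v w)
    split w with pos π w <ᵇ pos π v | <ᵇ-reflects-< (pos π w) (pos π v)
    ... | true  | _        = ≤-trans (ind≤1 _) (m≤m+n 1 _)
    ... | false | ofⁿ w≮v rewrite <ᵇ-true (n<1+n (pos π v))
        with pos π w <ᵇ suc (pos π v) | <ᵇ-reflects-< (pos π w) (suc (pos π v))
    ...   | false | _         = ≤-refl
    ...   | true  | ofʸ w<1+v
          with pos-injective π (≤-antisym (≮⇒≥ w≮v) (≤-pred w<1+v))
    ...     | refl rewrite loopless T v = z≤n

  -- A vertex w before v is an out-neighbour of v, or w → v leaves π[pos v].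
  pos≤outdeg+k : ∀ v → pos π v ≤ outdeg T v + k
  pos≤outdeg+k v = begin
    pos π v
      ≡⟨ m≤n⇒m⊓n≡m (<⇒≤ (toℕ<n (π ⟨$⟩ˡ v))) ⟨
    pos π v ⊓ n
      ≡⟨ count-prefix π (pos π v) ⟨
    ∑[ w < n ] ind (P w)
      ≤⟨ ∑-mono split ⟩
    ∑[ w < n ] (ind (adj T v w) + ind (P w ∧ not (P v) ∧ adj T w v))
      ≡⟨ ∑-distrib-+ (λ w → ind (adj T v w)) (λ w → ind (P w ∧ not (P v) ∧ adj T w v)) ⟩
    ∑[ w < n ] ind (adj T v w) + ∑[ w < n ] ind (P w ∧ not (P v) ∧ adj T w v)
      ≤⟨ +-mono-≤ (≤-reflexive (sym (count≡∑ (adj T v))))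
                  (≤-trans (column≤arcs T P (compl P) v) (small-cuts (pos π v))) ⟩
    outdeg T v + k ∎
    where
    open ≤-Reasoning
    P : Fin n → Bool
    P = prefix π (pos π v)
    split : ∀ w → ind (P w) ≤ ind (adj T v w) + ind (P w ∧ not (P v) ∧ adj T w v)
    split w with pos π w <ᵇ pos π v | <ᵇ-reflects-< (pos π w) (pos π v)
    ... | false | _       = z≤n
    ... | true  | ofʸ w<v
        with semicomplete T v w (λ v≡w → <-irrefl (cong (pos π) (sym v≡w)) w<v)
    ...   | inj₁ v→w rewrite v→w = s≤s z≤n
    ...   | inj₂ w→v rewrite w→v | <ᵇ-false (<-irrefl {pos π v} refl) = m≤n+m 1 _

  tangle-arcs : (X : Fin n → Bool) →
                (∀ v w → X v ≡ true → X w ≡ false → outdeg T v ≤ outdeg T w) →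
                arcs T X (compl X) ≤ k + k + suc (k + k) * suc (k + k)
  tangle-arcs X sorted with separating-threshold X (outdeg T) sorted
  ... | D , below , above = begin
    arcs T X (compl X)
      ≤⟨ arcs≤two-cuts+window T X P Q X⊆Q Y∩P=∅ ⟩
    cut T π (D ∸ k) + cut T π (suc (D + k)) + count (Q ∖ P) * count (Q ∖ P)
      ≤⟨ +-mono-≤ (+-mono-≤ (small-cuts (D ∸ k)) (small-cuts (suc (D + k))))
                  (*-mono-≤ window window) ⟩
    k + k + suc (k + k) * suc (k + k) ∎
    where
    open ≤-Reasoning
    P Q : Fin n → Bool
    P = prefix π (D ∸ k)
    Q = prefix π (suc (D + k))
    X⊆Q : ∀ v → X v ≡ true → Q v ≡ true
    X⊆Q v Xv = <ᵇ-true (s≤s (≤-trans (pos≤outdeg+k v) (+-monoˡ-≤ k (below v Xv))))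
    Y∩P=∅ : ∀ w → X w ≡ false → P w ≡ false
    Y∩P=∅ w Xw = <ᵇ-false (λ w<D∸k → <⇒≱ w<D∸k D∸k≤pos)
      where
      D∸k≤pos : D ∸ k ≤ pos π w
      D∸k≤pos = m≤n+o⇒m∸n≤o D k (≤-trans (above w Xw)
                  (≤-trans (outdeg≤pos+k w) (≤-reflexive (+-comm (pos π w) k))))
    window : count (Q ∖ P) ≤ suc (k + k)
    window = ≤-trans (count-window π (≤-trans (m∸n≤m D k) (≤-trans (m≤m+n D k) (n≤1+n _))))
                     (window-length D k)

tangle-threshold-split : ∀ k → 100 * (k * k) + 22 * k + 1 + 1
                         ≡ (k + k + suc (k + k) * suc (k + k)) + suc (96 * (k * k) + 16 * k)
tangle-threshold-split = solve-∀

tangle-threshold-exceeds : ∀ k → k + k + suc (k + k) * suc (k + k) < 100 * (k * k) + 22 * k + 1 + 1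
tangle-threshold-exceeds k =
  ≤-trans (m<m+n _ z<s) (≤-reflexive (sym (tangle-threshold-split k)))

lemma16 : (n : ℕ) (T : SemiComplete n) (k : ℕ) →
          HasBackwardTangle T ((100 * (k * k) + 22 * k + 1) + 1) →
          CtwGreaterThan T k
lemma16 n T k (X , many-arcs , sorted) π with width T π ≤? k
... | no  width≰k = ≰⇒> width≰k
... | yes width≤k = ⊥-elim (<⇒≱ (tangle-threshold-exceeds k) (≤-trans many-arcs few-arcs))
  where
  few-arcs : arcs T X (compl X) ≤ k + k + suc (k + k) * suc (k + k)
  few-arcs = SmallCuts.tangle-arcs T π k (λ α → ≤-trans (cut≤width T π α) width≤k) X sorted
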